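{- Let $H=(S_0,e_0,S_1,e_1,\dots)$ be a history of the Simpler Lazy Set algorithm, let $S_i$ be a state of $H$, and let $a\neq b$ be active addresses of $S_i$ such that there is a path $Q$ from $a$ to $b$ in $S_i$, but there is no path from $a$ to $b$ in $S_{i+1}$. Let $b^-$ be the address on $Q$ preceding $b$ (so $\mathrm{Next}^{S_i}(b^-)=b$). Then (1) $b^-$ and $b$ are on the main branch of $S_i$, and (2) $(S_i,e_i,S_{i+1})$ is an $\mathrm{RM}$ step that removes $b$ from the main branch by setting $\mathrm{Next}^{S_{i+1}}(b^-)=\mathrm{Next}^{S_i}(b)$.
   Context: Fix an infinite set $A$ of addresses with distinguished $\mathsf H,\mathsf T$, and finitely many processes. A state $S$: finite $\mathrm{Active}^S\subseteq A$ containing $\mathsf H,\mathsf T$; $\mathrm{Val}^S:\mathrm{Active}^S\to\mathbb N\cup\{ -1,\infty\}$ with $\mathrm{Val}(\mathsf H)=-1$, $\mathrm{Val}(\mathsf T)=\infty$, natural values otherwise; $\mathrm{Next}^S:\mathrm{Active}^S\setminus\{\mathsf T\}\to A$; for each process $p$: $PC_p\in\{0,1,2,3.1,\dots,3.5\}$, $x_p\in\mathbb N$, an address variable $\mathrm{curr}_p$. $S$ is normal if $\mathrm{Next}$ maps active addresses to active ones with $\mathrm{Val}(a)<\mathrm{Val}(\mathrm{Next}(a))$. A path is a sequence $c_1,\dots,c_m$ ($m>1$) of active addresses with $\mathrm{Next}(c_k)=c_{k+1}$; the path from $\mathsf H$ to $\mathsf T$ is the main branch. Initial state: $\mathrm{Active}=\{\mathsf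 H,\mathsf T\}$, $\mathrm{Next}(\mathsf H)=\mathsf T$, all $PC_p=0$. Steps $(S,e,T)$ by $p$ (unmentioned items unchanged): invocation $PC_p:0\to1,2,3.1$ with $x_p$ set arbitrarily; failure $PC_p:1\to0$ or $2\to0$; $\mathrm{AD}(x)$ ($x=x_p$, $PC_p:1\to0$): with $u$ on the main branch, $\mathrm{Val}(u)<x\le\mathrm{Val}(\mathrm{Next}(u))$: if $\mathrm{Val}(\mathrm{Next}(u))=x$ no change; else a new $a\notin\mathrm{Active}^S$ becomes active with $\mathrm{Val}(a)=x$, $\mathrm{Next}^T(u)=a$, $\mathrm{Next}^T(a)=\mathrm{Next}^S(u)$; $\mathrm{RM}(x)$ ($PC_p:2\to0$): if some main-branch $d$ has value $x$, with main-branch predecessor $c$, set $\mathrm{Next}^T(c)=\mathrm{Next}^S(d)$ (the step removes $d$ from the main branch), else no change; CONTAINS steps (lines 3.1–3.5) change only $PC_p$, $\mathrm{curr}_p$ (set to $\mathsf H$ or to $\mathrm{Next}(\mathrm{curr}_p)$) and the returned status. A history is a sequence $S_0,e_0,S_1,\dots$ with $S_0$ initial and every $(S_i,e_i,S_{i+1})$ a step; all its states are normal. -}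

module Defs where

open import Data.Nat using (ℕ; zero; suc; _<_; _≤_)
open import Data.Fin using (Fin)
open import Data.List using (List; []; _∷_; head; last)
open import Data.List.Membership.Propositional using (_∈_)
open import Data.Maybe using (Maybe; just; nothing)
open import Data.Product using (Σ; ∃; _×_; _,_)
open import Data.Sum using (_⊎_)
open import Data.Unit using (⊤)
open import Relation.Binary.PropositionalEquality using (_≡_; _≢_)
open import Relation.Nullary using (¬_)

data Value : Set where
  neg1 : Value
  fin  : ℕ → Value
  inf  : Value

data _<V_ : Value → Value → Set where
  neg1<fin : ∀ {n} → neg1 <V fin n
  neg1<inf : neg1 <V inf
  fin<fin  : ∀ {m n} → m < n → fin m <V fin n
  fin<inf  : ∀ {n} → fin n <V inf

_≤V_ : Value → Value → Set
u ≤V v = u <V v ⊎ u ≡ v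

data PCv : Set where
  pc0 pc1 pc2 pc31 pc32 pc33 pc34 pc35 : PCv

record Setup : Set₁ where
  field
    A       : Set
    H T     : A
    H≢T     : H ≢ T
    inj     : ℕ → A
    inj-inj : ∀ m n → inj m ≡ inj n → m ≡ n
    nproc   : ℕ

data Event (n : ℕ) : Set where
  invoke fail ad rm contains : Fin n → Event n

module _ (U : Setup) where
  open Setup U

  Proc : Set
  Proc = Fin nproc

  record State : Set₁ where
    field
      Active   : A → Set
      finite   : Σ (List A) λ l → ∀ c → Active c → c ∈ l
      H-active : Active H
      T-active : Active T
      Val      : A → Value
      Val-H    : Val H ≡ neg1
      Val-T    : Val T ≡ inf
      Val-nat  : ∀ c → Active c → c ≢ H → c ≢ T → ∃ λ k → Val c ≡ fin k
      -- Next is only meaningful on Active \ {T}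
      Next     : A → A
      PC       : Proc → PCv
      x        : Proc → ℕ
      curr     : Proc → A
  open State public

  Normal : State → Set
  Normal S = ∀ c → Active S c → c ≢ T →
             Active S (Next S c) × (Val S c <V Val S (Next S c))

  data IsPath (S : State) : List A → Set where
    two  : ∀ {c d} → Active S c → c ≢ T → Next S c ≡ d → Active S d →
           IsPath S (c ∷ d ∷ [])
    more : ∀ {c d cs} → Active S c → c ≢ T → Next S c ≡ d →
           IsPath S (d ∷ cs) → IsPath S (c ∷ d ∷ cs)

  PathFromTo : State → A → A → Set
  PathFromTo S a b = Σ (List A) λ cs → IsPath S cs × head cs ≡ just a × last cs ≡ just b

  OnMain : State → A → Set
  OnMain S c = Σ (List A) λ cs →
    IsPath S cs × head cs ≡ just H × last cs ≡ just T × c ∈ cs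

  Initial : State → Set
  Initial S = (∀ c → Active S c → c ≡ H ⊎ c ≡ T) × Next S H ≡ T × (∀ p → PC S p ≡ pc0)

  SameActive : State → State → Set
  SameActive S S' = ∀ c → (Active S c → Active S' c) × (Active S' c → Active S c)

  SameVal : State → State → Set
  SameVal S S' = ∀ c → Active S c → Val S' c ≡ Val S c

  SameNext : State → State → Set
  SameNext S S' = ∀ c → Active S c → c ≢ T → Next S' c ≡ Next S c

  SameShared : State → State → Set
  SameShared S S' = SameActive S S' × SameVal S S' × SameNext S S'

  OthersSame : Proc → State → State → Set
  OthersSame p S S' = ∀ q → q ≢ p →
    PC S' q ≡ PC S q × x S' q ≡ x S q × curr S' q ≡ curr S q

  data Step (S : State) : Event nproc → State → Set₁ where
    invocation : ∀ {S'} p → PC S p ≡ pc0 →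
      (PC S' p ≡ pc1 ⊎ PC S' p ≡ pc2 ⊎ PC S' p ≡ pc31) →
      curr S' p ≡ curr S p → SameShared S S' → OthersSame p S S' →
      Step S (invoke p) S'
    failure : ∀ {S'} p → (PC S p ≡ pc1 ⊎ PC S p ≡ pc2) → PC S' p ≡ pc0 →
      x S' p ≡ x S p → curr S' p ≡ curr S p →
      SameShared S S' → OthersSame p S S' → Step S (fail p) S'
    ad-present : ∀ {S'} p (u : A) → PC S p ≡ pc1 → PC S' p ≡ pc0 →
      x S' p ≡ x S p → curr S' p ≡ curr S p →
      OnMain S u → Val S u <V fin (x S p) → Val S (Next S u) ≡ fin (x S p) →
      SameShared S S' → OthersSame p S S' → Step S (ad p) S'
    ad-insert : ∀ {S'} p (u a : A) → PC S p ≡ pc1 → PC S' p ≡ pc0 →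
      x S' p ≡ x S p → curr S' p ≡ curr S p →
      OnMain S u → Val S u <V fin (x S p) → fin (x S p) <V Val S (Next S u) →
      ¬ Active S a →
      (∀ c → (Active S' c → Active S c ⊎ c ≡ a) × (Active S c ⊎ c ≡ a → Active S' c)) →
      Val S' a ≡ fin (x S p) → SameVal S S' →
      Next S' u ≡ a → Next S' a ≡ Next S u →
      (∀ c → Active S c → c ≢ T → c ≢ u → Next S' c ≡ Next S c) →
      OthersSame p S S' → Step S (ad p) S'
    rm-found : ∀ {S'} p (c d : A) → PC S p ≡ pc2 → PC S' p ≡ pc0 →
      x S' p ≡ x S p → curr S' p ≡ curr S p →
      OnMain S d → Val S d ≡ fin (x S p) → OnMain S c → Next S c ≡ d →
      Next S' c ≡ Next S d →
      (∀ e → Active S e → e ≢ T → e ≢ c → Next S' e ≡ Next S e) →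
      SameActive S S' → SameVal S S' → OthersSame p S S' → Step S (rm p) S'
    rm-absent : ∀ {S'} p → PC S p ≡ pc2 → PC S' p ≡ pc0 →
      x S' p ≡ x S p → curr S' p ≡ curr S p →
      (∀ d → OnMain S d → Val S d ≢ fin (x S p)) →
      SameShared S S' → OthersSame p S S' → Step S (rm p) S'
    contains-step : ∀ {S'} p →
      (PC S p ≡ pc31 ⊎ PC S p ≡ pc32 ⊎ PC S p ≡ pc33 ⊎ PC S p ≡ pc34 ⊎ PC S p ≡ pc35) →
      (PC S' p ≡ pc0 ⊎ PC S' p ≡ pc31 ⊎ PC S' p ≡ pc32 ⊎ PC S' p ≡ pc33 ⊎ PC S' p ≡ pc34 ⊎ PC S' p ≡ pc35) →
      x S' p ≡ x S p →
      (curr S' p ≡ curr S p ⊎ curr S' p ≡ H ⊎ curr S' p ≡ Next S (curr S p)) →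
      SameShared S S' → OthersSame p S S' → Step S (contains p) S'

  -- index bound: nothing = infinite history, just N = N steps (N+1 states)
  _<ᴹ_ : ℕ → Maybe ℕ → Set
  i <ᴹ nothing = ⊤
  i <ᴹ just N  = i < N

  _≤ᴹ_ : ℕ → Maybe ℕ → Set
  i ≤ᴹ nothing = ⊤
  i ≤ᴹ just N  = i ≤ N

  record History : Set₁ where
    field
      len     : Maybe ℕ
      st      : ℕ → State
      ev      : ℕ → Event nproc
      initial : Initial (st 0)
      steps   : ∀ i → i <ᴹ len → Step (st i) (ev i) (st (suc i))
      normal  : ∀ i → i ≤ᴹ len → Normal (st i)
  open History public

-- A step can only destroy a path by destroying one of its edges c → Next c.
-- Every step other than AD-insertion and a successful RM keeps all edges, and
-- an insertion replaces the edge u → Next u by the path u → a → Next u.  A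
-- successful RM replaces the edge c → d by c → Next d, which bypasses d only:
-- a path survives unless its final edge is exactly c → d, and then b⁻ = c and
-- b = d are the main-branch nodes the RM step uses.
module Submission where

open import Defs
open import Data.Empty using (⊥-elim)
open import Data.List using (List; []; _∷_; _++_; _∷ʳ_; [_]; head; last)
open import Data.List.Membership.Propositional using (_∈_)
open import Data.List.Properties using (∷ʳ-injective; ∷ʳ-injectiveʳ; ∷ʳ-++)
open import Data.List.Relation.Unary.Any using (here; there)
open import Data.Maybe using (just; nothing)
open import Data.Nat using (ℕ; zero; suc)
open import Data.Nat.Properties using (<⇒≤)
open import Data.Product using (Σ; _×_; _,_; proj₁; proj₂)
open import Data.Sum using (_⊎_; inj₁; inj₂)
open import Data.Unit using (tt)
open import Relation.Binary.PropositionalEquality using (_≡_; _≢_; refl; sym; trans; cong)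
open import Relation.Nullary using (¬_; Dec; yes; no)

module _ {A : Set} where

  last-++-∷ : ∀ (xs : List A) {y} ys → last (xs ++ y ∷ ys) ≡ last (y ∷ ys)
  last-++-∷ []            ys = refl
  last-++-∷ (_ ∷ [])      ys = refl
  last-++-∷ (_ ∷ x ∷ xs)  ys = last-++-∷ (x ∷ xs) ys

  ++-∷-∷-injective : ∀ (xs ys : List A) {x y x′ y′} →
    xs ++ x ∷ y ∷ [] ≡ ys ++ x′ ∷ y′ ∷ [] → x ≡ x′ × y ≡ y′
  ++-∷-∷-injective xs ys {x} {y} {x′} {y′} eq
    with eq′ , y≡y′ ← ∷ʳ-injective (xs ∷ʳ x) (ys ∷ʳ x′)
           (trans (∷ʳ-++ xs x [ y ]) (trans eq (sym (∷ʳ-++ ys x′ [ y′ ]))))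
    = ∷ʳ-injectiveʳ xs ys eq′ , y≡y′

module _ (U : Setup) where
  open Setup U

  <ᴹ⇒≤ᴹ : ∀ {i} m → _<ᴹ_ U i m → _≤ᴹ_ U i m
  <ᴹ⇒≤ᴹ nothing  _   = tt
  <ᴹ⇒≤ᴹ (just _) i<N = <⇒≤ i<N

  suc≤ᴹ⇒<ᴹ : ∀ {i} m → _≤ᴹ_ U (suc i) m → _<ᴹ_ U i m
  suc≤ᴹ⇒<ᴹ nothing  _ = tt
  suc≤ᴹ⇒<ᴹ (just _) i<N = i<N

  -- Addresses form an abstract type, so telling whether a path passes through the
  -- node an AD or RM step modifies needs this invariant; it holds because initially
  -- only H ≢ T are active and each insertion activates one fresh address.
  ActiveDecEq : State U → Set
  ActiveDecEq S = ∀ {c d} → Active S c → Active S d → Dec (c ≡ d)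

  initial⇒activeDecEq : ∀ {S} → Initial U S → ActiveDecEq S
  initial⇒activeDecEq (H-or-T , _) {c} {d} Ac Ad with H-or-T c Ac | H-or-T d Ad
  ... | inj₁ refl | inj₁ refl = yes refl
  ... | inj₁ refl | inj₂ refl = no H≢T
  ... | inj₂ refl | inj₁ refl = no (λ T≡H → H≢T (sym T≡H))
  ... | inj₂ refl | inj₂ refl = yes refl

  sameActive⇒activeDecEq : ∀ {S S′} → SameActive U S S′ → ActiveDecEq S → ActiveDecEq S′
  sameActive⇒activeDecEq same dec Ac Ad = dec (proj₂ (same _) Ac) (proj₂ (same _) Ad)

  step⇒activeDecEq : ∀ {S e S′} → Step U S e S′ → ActiveDecEq S → ActiveDecEq S′
  step⇒activeDecEq {S} {_} {S′} (ad-insert _ _ _ _ _ _ _ _ _ _ ¬Aa act _ _ _ _ _ _) dec Ac Ad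
    with proj₁ (act _) Ac | proj₁ (act _) Ad
  ... | inj₁ Ac′  | inj₁ Ad′  = dec Ac′ Ad′
  ... | inj₁ Ac′  | inj₂ refl = no λ { refl → ¬Aa Ac′ }
  ... | inj₂ refl | inj₁ Ad′  = no λ { refl → ¬Aa Ad′ }
  ... | inj₂ refl | inj₂ refl = yes refl
  step⇒activeDecEq {S} {_} {S′} (rm-found _ _ _ _ _ _ _ _ _ _ _ _ _ s _ _) =
    sameActive⇒activeDecEq {S} {S′} s
  step⇒activeDecEq {S} {_} {S′} (invocation _ _ _ _ s _) =
    sameActive⇒activeDecEq {S} {S′} (proj₁ s)
  step⇒activeDecEq {S} {_} {S′} (failure _ _ _ _ _ s _) =
    sameActive⇒activeDecEq {S} {S′} (proj₁ s)
  step⇒activeDecEq {S} {_} {S′} (ad-present _ _ _ _ _ _ _ _ _ s _) =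
    sameActive⇒activeDecEq {S} {S′} (proj₁ s)
  step⇒activeDecEq {S} {_} {S′} (rm-absent _ _ _ _ _ _ s _) =
    sameActive⇒activeDecEq {S} {S′} (proj₁ s)
  step⇒activeDecEq {S} {_} {S′} (contains-step _ _ _ _ _ s _) =
    sameActive⇒activeDecEq {S} {S′} (proj₁ s)

  history⇒activeDecEq : (h : History U) → ∀ i → _≤ᴹ_ U i (len h) → ActiveDecEq (st h i)
  history⇒activeDecEq h zero    _      = initial⇒activeDecEq {st h 0} (initial h)
  history⇒activeDecEq h (suc i) i+1≤len =
    step⇒activeDecEq (steps h i i<len) (history⇒activeDecEq h i (<ᴹ⇒≤ᴹ (len h) i<len))
    where i<len = suc≤ᴹ⇒<ᴹ (len h) i+1≤len

  ∈-path⇒active : ∀ {S cs c} → IsPath U S cs → c ∈ cs → Active S c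
  ∈-path⇒active (two Ac _ _ _)  (here refl)         = Ac
  ∈-path⇒active (two _ _ _ Ad)  (there (here refl)) = Ad
  ∈-path⇒active (more Ac _ _ _) (here refl)         = Ac
  ∈-path⇒active (more _ _ _ p)  (there c∈cs)        = ∈-path⇒active p c∈cs

  onMain⇒active : ∀ {S c} → OnMain U S c → Active S c
  onMain⇒active (_ , p , _ , _ , c∈cs) = ∈-path⇒active p c∈cs

  module _ {S : State U} where

    edge-path : ∀ {c d} → Active S c → c ≢ T → Next S c ≡ d → Active S d → PathFromTo U S c d
    edge-path Ac c≢T cd Ad = _ , two Ac c≢T cd Ad , refl , refl

    edge-∷-path : ∀ {c d y} → Active S c → c ≢ T → Next S c ≡ d →
      PathFromTo U S d y → PathFromTo U S c y
    edge-∷-path Ac c≢T cd (_ ∷ _ , p , refl , py) = _ , more Ac c≢T cd p , refl , py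

    path-trans : ∀ {x y z} → PathFromTo U S x y → PathFromTo U S y z → PathFromTo U S x z
    path-trans (_ , two Ac c≢T cd _ , refl , refl) q = edge-∷-path Ac c≢T cd q
    path-trans (_ ∷ _ ∷ cs , more Ac c≢T cd p , refl , py) q =
      edge-∷-path Ac c≢T cd (path-trans (_ , p , refl , py) q)

  EdgesKept : State U → State U → Set
  EdgesKept S S′ = ∀ {c d} → Active S c → c ≢ T → Next S c ≡ d → Active S d → PathFromTo U S′ c d

  edgesKept⇒pathsKept : ∀ {S S′ x y} → EdgesKept S S′ → PathFromTo U S x y → PathFromTo U S′ x y
  edgesKept⇒pathsKept kept (_ , two Ac c≢T cd Ad , refl , refl) = kept Ac c≢T cd Ad
  edgesKept⇒pathsKept kept (_ ∷ _ ∷ cs , more Ac c≢T cd p , refl , py) =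
    path-trans (kept Ac c≢T cd (∈-path⇒active p (here refl)))
               (edgesKept⇒pathsKept kept (_ , p , refl , py))

  sameShared⇒edgesKept : ∀ {S S′} → SameShared U S S′ → EdgesKept S S′
  sameShared⇒edgesKept (same , _ , sameNext) Ac c≢T cd Ad =
    edge-path (proj₁ (same _) Ac) c≢T (trans (sameNext _ Ac c≢T) cd) (proj₁ (same _) Ad)

  insertion⇒edgesKept : ∀ {S S′ u a} → ActiveDecEq S → Active S u → ¬ Active S a →
    (∀ c → Active S c → Active S′ c) → Active S′ a →
    Next S′ u ≡ a → Next S′ a ≡ Next S u →
    (∀ c → Active S c → c ≢ T → c ≢ u → Next S′ c ≡ Next S c) → EdgesKept S S′
  insertion⇒edgesKept {S} dec Au ¬Aa act A′a ua a-next others {c} Ac c≢T cd Ad with dec Ac Au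
  ... | yes refl = edge-∷-path (act _ Ac) c≢T ua (edge-path A′a a≢T (trans a-next cd) (act _ Ad))
    where
    a≢T : _ ≢ T
    a≢T refl = ¬Aa (T-active S)
  ... | no c≢u = edge-path (act _ Ac) c≢T (trans (others _ Ac c≢T c≢u) cd) (act _ Ad)

  module _ {S S′ : State U} {c d : A} (dec : ActiveDecEq S) (Ac : Active S c)
    (act : ∀ e → Active S e → Active S′ e) (cd : Next S c ≡ d) (c-next : Next S′ c ≡ Next S d)
    (others : ∀ e → Active S e → e ≢ T → e ≢ c → Next S′ e ≡ Next S e) where

    bypass : ∀ {d′ f} → Next S c ≡ d′ → Next S d′ ≡ f → Next S′ c ≡ f
    bypass cd′ d′f = trans c-next (trans (cong (Next S) (trans (sym cd) cd′)) d′f)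

    removal-keeps-path-unless-last-edge : ∀ {cs x y} → IsPath U S cs →
      head cs ≡ just x → last cs ≡ just y →
      PathFromTo U S′ x y ⊎ Σ (List A) (λ pre → cs ≡ pre ++ c ∷ d ∷ [])
    removal-keeps-path-unless-last-edge (two {e} Ae e≢T ed Ad) refl refl with dec Ae Ac
    ... | yes refl = inj₂ ([] , cong (λ f → c ∷ f ∷ []) (trans (sym ed) cd))
    ... | no e≢c = inj₁ (edge-path (act _ Ae) e≢T (trans (others _ Ae e≢T e≢c) ed) (act _ Ad))
    removal-keeps-path-unless-last-edge (more {e} Ae e≢T ed p) refl py with dec Ae Ac
    ... | no e≢c with removal-keeps-path-unless-last-edge p refl py
    ...   | inj₁ q          = inj₁ (edge-∷-path (act _ Ae) e≢T (trans (others _ Ae e≢T e≢c) ed) q)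
    ...   | inj₂ (pre , eq) = inj₂ (e ∷ pre , cong (e ∷_) eq)
    removal-keeps-path-unless-last-edge (more Ae e≢T ed (two _ _ d′f Af)) refl refl | yes refl =
      inj₁ (edge-path (act _ Ae) e≢T (bypass ed d′f) (act _ Af))
    removal-keeps-path-unless-last-edge (more {_} {d′} Ae e≢T ed (more _ _ d′f p)) refl py | yes refl
      with removal-keeps-path-unless-last-edge p refl py
    ... | inj₁ q          = inj₁ (edge-∷-path (act _ Ae) e≢T (bypass ed d′f) q)
    ... | inj₂ (pre , eq) = inj₂ (c ∷ d′ ∷ pre , cong (λ cs → c ∷ d′ ∷ cs) eq)

  RemovesFromMain : State U → Event nproc → State U → A → A → Set
  RemovesFromMain S e S′ b⁻ b = (OnMain U S b⁻ × OnMain U S b) ×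
    Σ (Proc U) (λ p → e ≡ rm p × Val S b ≡ fin (x S p) × Next S′ b⁻ ≡ Next S b)

  path-breaking-step⇒removesFromMain : ∀ {S e S′ a b b⁻} → ActiveDecEq S → Step U S e S′ →
    (pre : List A) → IsPath U S (pre ++ b⁻ ∷ b ∷ []) → head (pre ++ b⁻ ∷ b ∷ []) ≡ just a →
    ¬ PathFromTo U S′ a b → RemovesFromMain S e S′ b⁻ b
  path-breaking-step⇒removesFromMain {S} {e} {S′} {_} {b} {b⁻} dec step pre Q Q-a ¬a⇝b = go step
    where
    Q-b : last (pre ++ b⁻ ∷ b ∷ []) ≡ just b
    Q-b = last-++-∷ pre (b ∷ [])

    edges-broken : ¬ EdgesKept S S′
    edges-broken kept = ¬a⇝b (edgesKept⇒pathsKept kept (_ , Q , Q-a , Q-b))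

    unchanged : SameShared U S S′ → RemovesFromMain S e S′ b⁻ b
    unchanged s = ⊥-elim (edges-broken (sameShared⇒edgesKept {S} {S′} s))

    go : Step U S e S′ → RemovesFromMain S e S′ b⁻ b
    go (invocation _ _ _ _ s _)           = unchanged s
    go (failure _ _ _ _ _ s _)            = unchanged s
    go (ad-present _ _ _ _ _ _ _ _ _ s _) = unchanged s
    go (ad-insert _ u a _ _ _ _ u-main _ _ ¬Aa act _ _ ua a-next others _) =
      ⊥-elim (edges-broken (insertion⇒edgesKept {S} {S′} dec (onMain⇒active u-main) ¬Aa
        (λ c Ac → proj₂ (act c) (inj₁ Ac)) (proj₂ (act a) (inj₂ refl)) ua a-next others))
    go (rm-found p c d _ _ _ _ d-main d-val c-main cd c-next others same _ _)
      with removal-keeps-path-unless-last-edge dec (onMain⇒active c-main)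
             (λ e Ae → proj₁ (same e) Ae) cd c-next others Q Q-a Q-b
    ... | inj₁ a⇝b = ⊥-elim (¬a⇝b a⇝b)
    ... | inj₂ (pre′ , eq) with refl , refl ← ++-∷-∷-injective pre pre′ eq =
      (c-main , d-main) , p , refl , d-val , c-next
    go (rm-absent _ _ _ _ _ _ s _)        = unchanged s
    go (contains-step _ _ _ _ _ s _)      = unchanged s

lemma4p10 : (U : Setup) (h : History U) (i : ℕ) → _<ᴹ_ U i (len h) →
    (a b : Setup.A U) →
    Active (st h i) a → Active (st h i) b → a ≢ b →
    (pre : List (Setup.A U)) (b⁻ : Setup.A U) →
    IsPath U (st h i) (pre ++ b⁻ ∷ b ∷ []) →
    head (pre ++ b⁻ ∷ b ∷ []) ≡ just a →
    ¬ PathFromTo U (st h (suc i)) a b →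
    (OnMain U (st h i) b⁻ × OnMain U (st h i) b) ×
    Σ (Proc U) (λ p →
      ev h i ≡ rm p ×
      Val (st h i) b ≡ fin (x (st h i) p) ×
      Next (st h (suc i)) b⁻ ≡ Next (st h i) b)
lemma4p10 U h i i<len a b _ _ _ pre b⁻ Q Q-a ¬a⇝b =
  path-breaking-step⇒removesFromMain U (history⇒activeDecEq U h i (<ᴹ⇒≤ᴹ U (len h) i<len))
    (steps h i i<len) pre Q Q-a ¬a⇝b
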